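{- Define polynomials $P_k,Q_k$ by $P_0(t)=Q_0(t)=1$, $P_{k+1}(t)=tP_k(t)+P_k'(t)$ for $k\ge0$, and $Q_k(t)=P_k(t)+Q_{k-1}'(t)$ for $k\ge1$, and write $P_k(t)=\sum_m p_{k,m}t^m$, $Q_k(t)=\sum_m q_{k,m}t^m$. Then $q_{k,m}=0$ whenever $k-m$ is odd, and whenever $k\equiv m\pmod 2$, with $n=\frac{k-m}{2}$, $$m!\,q_{k,m}=\sum_{j=0}^n (m+j)!\,p_{k-j,m+j}.$$ -}

module Defs where

open import Data.Nat using (ℕ; zero; suc; _+_; _*_)

-- A polynomial with natural-number coefficients, represented by its
-- coefficient sequence: (f m) is the coefficient of t^m.
Poly : Set
Poly = ℕ → ℕ

coeff : Poly → ℕ → ℕ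
coeff f m = f m

one : Poly
one zero    = 1
one (suc _) = 0

_⊕_ : Poly → Poly → Poly
(f ⊕ g) m = f m + g m

mulT : Poly → Poly
mulT f zero    = 0
mulT f (suc m) = f m

deriv : Poly → Poly
deriv f m = suc m * f (suc m)

P : ℕ → Poly
P zero    = one
P (suc k) = mulT (P k) ⊕ deriv (P k)

Q : ℕ → Poly
Q zero    = one
Q (suc k) = P (suc k) ⊕ deriv (Q k)

p : ℕ → ℕ → ℕ
p k m = coeff (P k) m

q : ℕ → ℕ → ℕ
q k m = coeff (Q k) m

sumTo : ℕ → (ℕ → ℕ) → ℕ
sumTo zero    f = f 0
sumTo (suc n) f = sumTo n f + f (suc n)

-- In coefficients the defining recurrences read
--   p_{k+1,m} = p_{k,m-1} + (m+1) p_{k,m+1},   q_{k+1,m} = p_{k+1,m} + (m+1) q_{k,m+1}.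
-- Both only look at positions (k, m±1) one step lower, starting from the single
-- nonzero coefficient at (0,0).  Hence p and q vanish on every set of index pairs
-- that avoids (0,0) and is inherited by those lower positions (a "zero region").
-- Two zero regions are needed: pairs of different parity, and pairs with k < m;
-- the first is part one of the theorem, the second gives q_{m,m} = p_{m,m}.
-- Multiplying the q-recurrence by m! turns it into
--   m! q_{k+1,m} = m! p_{k+1,m} + (m+1)! q_{k,m+1},
-- which telescopes along the diagonal k - m = 2n down to q_{m,m} = p_{m,m}; this
-- is part two, once k ≡ m (mod 2) with m ≤ k is rewritten as k = 2n + m.
module Submission where

open import Defs
open import Data.Nat using (ℕ; zero; suc; _!; _+_; _*_; _∸_; _≤_; _<_; _/_; _%_; s≤s⁻¹)
open import Data.Nat.Properties
  using (+-identityʳ; +-assoc; n<1+n; +-suc; *-assoc; *-comm; *-distribˡ-+; *-zeroʳ; <⇒≤; m<n⇒m<1+n;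
         m∸n+n≡m; m+n∸n≡m)
open import Data.Nat.DivMod using (m*n/n≡m)
open import Data.Bool using (Bool; true; false; not)
open import Data.Bool.Properties using (not-involutive; not-¬)
open import Data.Product using (_×_; _,_; ∃-syntax)
open import Data.Empty using (⊥-elim)
open import Relation.Nullary using (¬_)
open import Relation.Binary.PropositionalEquality
  using (_≡_; _≢_; refl; sym; trans; cong; cong₂)
open Relation.Binary.PropositionalEquality.≡-Reasoning

sumTo-cong : ∀ n {f g : ℕ → ℕ} → (∀ j → f j ≡ g j) → sumTo n f ≡ sumTo n g
sumTo-cong zero    f≡g = f≡g 0
sumTo-cong (suc n) f≡g = cong₂ _+_ (sumTo-cong n f≡g) (f≡g (suc n))

sumTo-unfold : ∀ n (f : ℕ → ℕ) → sumTo (suc n) f ≡ f 0 + sumTo n (λ j → f (suc j))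
sumTo-unfold zero    f = refl
sumTo-unfold (suc n) f = begin
  sumTo n f + f (suc n) + f (suc (suc n))
    ≡⟨ cong (_+ f (suc (suc n))) (sumTo-unfold n f) ⟩
  f 0 + sumTo n (λ j → f (suc j)) + f (suc (suc n))
    ≡⟨ +-assoc (f 0) _ _ ⟩
  f 0 + sumTo (suc n) (λ j → f (suc j))
    ∎

record ZeroRegion (R : ℕ → ℕ → Set) : Set where
  field
    avoids-origin : ¬ R 0 0
    -- p_{k+1,m+1} uses p_{k,m}
    down : ∀ {k m} → R (suc k) (suc m) → R k m
    -- p_{k+1,m} and q_{k+1,m} use p_{k,m+1} and q_{k,m+1}
    up   : ∀ {k m} → R (suc k) m → R k (suc m)

module _ {R : ℕ → ℕ → Set} (region : ZeroRegion R) where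
  open ZeroRegion region

  p-vanishes : ∀ k m → R k m → p k m ≡ 0
  p-vanishes zero    zero    r = ⊥-elim (avoids-origin r)
  p-vanishes zero    (suc m) r = refl
  p-vanishes (suc k) zero    r = cong (λ x → x + 0) (p-vanishes k 1 (up r))
  p-vanishes (suc k) (suc m) r = begin
    p k m + suc (suc m) * p k (suc (suc m))
      ≡⟨ cong₂ (λ x y → x + suc (suc m) * y)
               (p-vanishes k m (down r)) (p-vanishes k (suc (suc m)) (up r)) ⟩
    suc (suc m) * 0
      ≡⟨ *-zeroʳ (suc (suc m)) ⟩
    0 ∎

  q-vanishes : ∀ k m → R k m → q k m ≡ 0
  q-vanishes zero    zero    r = ⊥-elim (avoids-origin r)
  q-vanishes zero    (suc m) r = refl
  q-vanishes (suc k) m       r = begin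
    p (suc k) m + suc m * q k (suc m)
      ≡⟨ cong₂ (λ x y → x + suc m * y) (p-vanishes (suc k) m r) (q-vanishes k (suc m) (up r)) ⟩
    suc m * 0
      ≡⟨ *-zeroʳ (suc m) ⟩
    0 ∎

parity : ℕ → Bool
parity zero    = false
parity (suc n) = not (parity n)

parity-mismatch : ZeroRegion (λ k m → parity k ≢ parity m)
parity-mismatch = record
  { avoids-origin = λ mismatch → mismatch refl
  ; down = λ mismatch same → mismatch (cong not same)
  ; up   = λ mismatch same → mismatch (trans (cong not same) (not-involutive _))
  }

above-degree : ZeroRegion _<_
above-degree = record
  { avoids-origin = λ ()
  ; down = s≤s⁻¹
  ; up   = λ k+1<m → m<n⇒m<1+n (<⇒≤ k+1<m)
  }

-- Leading coefficients agree: Q_m and P_m differ only in lower degrees.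
q-diagonal : ∀ m → q m m ≡ p m m
q-diagonal zero    = refl
q-diagonal (suc m) = begin
  p (suc m) (suc m) + suc (suc m) * q m (suc (suc m))
    ≡⟨ cong (λ y → p (suc m) (suc m) + suc (suc m) * y)
            (q-vanishes above-degree m (suc (suc m)) (m<n⇒m<1+n (n<1+n m))) ⟩
  p (suc m) (suc m) + suc (suc m) * 0
    ≡⟨ cong (p (suc m) (suc m) +_) (*-zeroʳ (suc (suc m))) ⟩
  p (suc m) (suc m) + 0
    ≡⟨ +-identityʳ _ ⟩
  p (suc m) (suc m) ∎

weighted-q-step : ∀ k m → m ! * q (suc k) m ≡ m ! * p (suc k) m + suc m ! * q k (suc m)
weighted-q-step k m = begin
  m ! * (p (suc k) m + suc m * q k (suc m))
    ≡⟨ *-distribˡ-+ (m !) _ _ ⟩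
  m ! * p (suc k) m + m ! * (suc m * q k (suc m))
    ≡⟨ cong (m ! * p (suc k) m +_) (sym (*-assoc (m !) (suc m) _)) ⟩
  m ! * p (suc k) m + m ! * suc m * q k (suc m)
    ≡⟨ cong (λ c → m ! * p (suc k) m + c * q k (suc m)) (*-comm (m !) (suc m)) ⟩
  m ! * p (suc k) m + suc m ! * q k (suc m) ∎

telescope : ∀ n m k → k ≡ n * 2 + m →
            m ! * q k m ≡ sumTo n (λ j → (m + j) ! * p (k ∸ j) (m + j))
telescope zero m .m refl = begin
  m ! * q m m              ≡⟨ cong (m ! *_) (q-diagonal m) ⟩
  m ! * p m m              ≡⟨ cong (λ i → i ! * p m i) (sym (+-identityʳ m)) ⟩
  (m + 0) ! * p m (m + 0)  ∎
telescope (suc n) m .(suc (suc (n * 2 + m))) refl = begin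
  m ! * q (suc K) m
    ≡⟨ weighted-q-step K m ⟩
  m ! * p (suc K) m + suc m ! * q K (suc m)
    ≡⟨ cong₂ _+_ (cong (λ i → i ! * p (suc K) i) (sym (+-identityʳ m)))
                 (telescope n (suc m) K (sym (+-suc (n * 2) m))) ⟩
  f 0 + sumTo n (λ j → (suc m + j) ! * p (K ∸ j) (suc m + j))
    ≡⟨ cong (f 0 +_) (sumTo-cong n λ j → cong (λ i → i ! * p (K ∸ j) i) (sym (+-suc m j))) ⟩
  f 0 + sumTo n (λ j → f (suc j))
    ≡⟨ sym (sumTo-unfold n f) ⟩
  sumTo (suc n) f ∎
  where
  K : ℕ
  K = suc (n * 2 + m)
  f : ℕ → ℕ
  f j = (m + j) ! * p (suc K ∸ j) (m + j)

-- The theorem speaks of remainders modulo 2; they are the parity read as a digit.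
bit : Bool → ℕ
bit false = 0
bit true  = 1

bit-injective : ∀ {a b} → bit a ≡ bit b → a ≡ b
bit-injective {false} {false} _ = refl
bit-injective {true}  {true}  _ = refl

%2≡bit-parity : ∀ m → m % 2 ≡ bit (parity m)
%2≡bit-parity zero          = refl
%2≡bit-parity (suc zero)    = refl
%2≡bit-parity (suc (suc m)) = trans (%2≡bit-parity m) (cong bit (sym (not-involutive _)))

same-parity⇒same-%2 : ∀ k m → parity k ≡ parity m → k % 2 ≡ m % 2
same-parity⇒same-%2 k m same =
  trans (%2≡bit-parity k) (trans (cong bit same) (sym (%2≡bit-parity m)))

same-%2⇒same-parity : ∀ k m → k % 2 ≡ m % 2 → parity k ≡ parity m
same-%2⇒same-parity k m same =
  bit-injective (trans (sym (%2≡bit-parity k)) (trans same (%2≡bit-parity m)))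

even-gap : ∀ d m → parity (d + m) ≡ parity m → ∃[ n ] d ≡ n * 2
even-gap zero          m _    = 0 , refl
even-gap (suc zero)    m same = ⊥-elim (not-¬ refl (sym same))
even-gap (suc (suc d)) m same with even-gap d m (trans (sym (not-involutive _)) same)
... | n , d≡2n = suc n , cong (λ x → suc (suc x)) d≡2n

same-parity-gap : ∀ {k m} → m ≤ k → parity k ≡ parity m → ∃[ n ] k ≡ n * 2 + m
same-parity-gap {k} {m} m≤k same
  with even-gap (k ∸ m) m (trans (cong parity (m∸n+n≡m m≤k)) same)
... | n , gap≡2n = n , trans (sym (m∸n+n≡m m≤k)) (cong (_+ m) gap≡2n)

lemma6 : ((k m : ℕ) → k % 2 ≢ m % 2 → q k m ≡ 0)
       × ((k m : ℕ) → k % 2 ≡ m % 2 → m ≤ k →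
            m ! * q k m ≡ sumTo ((k ∸ m) / 2) (λ j → (m + j) ! * p (k ∸ j) (m + j)))
lemma6 = odd-part , even-part
  where
  odd-part : (k m : ℕ) → k % 2 ≢ m % 2 → q k m ≡ 0
  odd-part k m differ =
    q-vanishes parity-mismatch k m (λ same → differ (same-parity⇒same-%2 k m same))

  even-part : (k m : ℕ) → k % 2 ≡ m % 2 → m ≤ k →
              m ! * q k m ≡ sumTo ((k ∸ m) / 2) (λ j → (m + j) ! * p (k ∸ j) (m + j))
  even-part k m same m≤k with same-parity-gap m≤k (same-%2⇒same-parity k m same)
  ... | n , refl =
    trans (telescope n m _ refl)
          (cong (λ N → sumTo N (λ j → (m + j) ! * p (n * 2 + m ∸ j) (m + j))) (sym half))
    where
    half : (n * 2 + m ∸ m) / 2 ≡ n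
    half = trans (cong (_/ 2) (m+n∸n≡m (n * 2) m)) (m*n/n≡m n 2)
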